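{- Let $p,q>1$ be relatively prime integers and let $\beta\in(0,1)$ be the unique solution of $p^{ -\beta}+q^{ -\beta}=1$. Then $W(U)\le U^\beta$ for every integer $U\ge1$.
   Context: A strictly chained $(p,q)$-ary partition of $U$ is a finite sequence of distinct positive integers of the form $p^aq^b$ ($a,b\ge0$) summing to $U$, in decreasing order, each part a multiple of the next. $W(U)$ is the number of such partitions of $U$. -}

module Defs where

open import Data.Nat using (ℕ; zero; suc; _+_; _*_; _^_; _≤_; _<_; _≟_)
open import Data.Nat.Divisibility using (_∣_; _∣?_)
open import Data.List using (List; []; _∷_; map; _++_; length; filter; downFrom; upTo)
open import Data.Nat.ListAction using (sum)
open import Data.List.Relation.Unary.All using (All; all?)
open import Data.List.Relation.Unary.Any using (Any; any?)
open import Data.List.Relation.Unary.Linked using (Linked; linked?)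
open import Data.Product using (Σ; _×_; ∃)
open import Relation.Binary.PropositionalEquality using (_≡_)
open import Relation.Nullary using (Dec)
open import Relation.Nullary.Decidable using (_×-dec_)

-- n is of the form p^i q^j.  The exponents are searched in 0..n, which is
-- exhaustive when p, q ≥ 2 (then p^i ≥ 2^i > i, so p^i q^j = n forces i, j < n+1).
IsPQ : ℕ → ℕ → ℕ → Set
IsPQ p q n = Any (λ i → Any (λ j → n ≡ p ^ i * q ^ j) (upTo (suc n))) (upTo (suc n))

isPQ? : ∀ p q n → Dec (IsPQ p q n)
isPQ? p q n = any? (λ i → any? (λ j → n ≟ p ^ i * q ^ j) (upTo (suc n))) (upTo (suc n))

IsChained : ℕ → ℕ → ℕ → List ℕ → Set
IsChained p q U xs = (sum xs ≡ U) × (All (IsPQ p q) xs × Linked (λ x y → y ∣ x) xs)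

isChained? : ∀ p q U xs → Dec (IsChained p q U xs)
isChained? p q U xs =
  (sum xs ≟ U) ×-dec (all? (isPQ? p q) xs ×-dec linked? (λ x y → y ∣? x) xs)

sublists : List ℕ → List (List ℕ)
sublists [] = [] ∷ []
sublists (x ∷ xs) = map (x ∷_) (sublists xs) ++ sublists xs

-- Candidates: all strictly decreasing lists of distinct positive integers ≤ U
-- (= sublists of [U, U-1, ..., 1]), each occurring exactly once.
candidates : ℕ → List (List ℕ)
candidates U = sublists (map suc (downFrom U))

W : ℕ → ℕ → ℕ → ℕ
W p q U = length (filter (isChained? p q U) candidates′)
  where candidates′ = candidates U

-- "a/b < β" where β is the solution of p^(-β) + q^(-β) = 1.
-- Since β ↦ p^(-β)+q^(-β) is strictly decreasing, a/b < β iff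
-- p^(-a/b) + q^(-a/b) > 1, iff there are rationals s = m/n < p^(-a/b),
-- t = k/n < q^(-a/b) with s + t ≥ 1, i.e. m^b p^a < n^b, k^b q^a < n^b, n ≤ m+k.
BelowBeta : ℕ → ℕ → ℕ → ℕ → Set
BelowBeta p q a b =
  Σ ℕ λ m → Σ ℕ λ k → Σ ℕ λ n →
    (n ≤ m + k) × ((m ^ b * p ^ a < n ^ b) × (k ^ b * q ^ a < n ^ b))

-- "w ≤ U^β": every rational a/b (b > 0) with U^(a/b) < w satisfies a/b < β.
-- (For U > 1 this says log w / log U ≤ β; for U = 1 it says w ≤ 1 since β < 1.)
LeUPowBeta : ℕ → ℕ → ℕ → ℕ → Set
LeUPowBeta p q w U = ∀ a b → 0 < b → U ^ a < w ^ b → BelowBeta p q a b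

{-# OPTIONS --safe #-}
module Submission where

-- A chained partition of U either ends in the part 1, whose removal leaves a chained partition
-- of U - 1, or has all parts at least 2.  In the latter case its smallest part p^i q^j ≠ 1 is
-- divisible by p or by q, hence so is every part, and dividing through gives a chained partition
-- of U/p or U/q (coprimality keeps the quotients of the form p^i q^j).  Since r > 1 divides at
-- most one of U - 1 and U, this gives W(U) ≤ W(A) + W(B) with pA ≤ U and qB ≤ U, and strong
-- induction closes with (U/p)^β + (U/q)^β = U^β.

open import Defs
open import Data.Empty using (⊥-elim)
open import Data.List using (List; []; _∷_; map; _++_; [_]; filter; length; downFrom)
open import Data.List.Membership.Propositional using (_∈_; lose)
open import Data.List.Membership.Propositional.Properties using (∈-++⁻; ∈-map⁻; ∈-upTo⁺)
open import Data.List.Properties using (++-identityʳ; filter-++; filter-none; filter-reject; length-++; map-++; map-∘)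
open import Data.List.Relation.Unary.All as All using (All; []; _∷_; all?)
open import Data.List.Relation.Unary.All.Properties using (map⁻; ++⁻ˡ)
open import Data.List.Relation.Unary.Any using (here; there; satisfied)
open import Data.List.Relation.Unary.Linked as Linked using (Linked; []; [-]; _∷_)
import Data.List.Relation.Unary.Linked.Properties as Linked
open import Data.Nat using (ℕ; zero; suc; _+_; _*_; _^_; _≤_; _<_; _<?_; z≤n; s≤s; NonZero; >-nonZero; >-nonZero⁻¹)
open import Data.Nat.Coprimality as Coprime using (Coprime; coprime-divisor)
open import Data.Nat.Divisibility
  using (_∣_; _∣?_; divides; _∣0; ∣-trans; ∣1⇒≡1; ∣m∣n⇒∣m+n; ∣m+n∣m⇒∣n; ∣m⇒∣m*n; ∣n⇒∣m*n; m∣m*n; *-cancelˡ-∣)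
open import Data.Nat.Induction using (<-Rec; <-rec)
open import Data.Nat.ListAction using (sum)
open import Data.Nat.ListAction.Properties using (sum-++)
open import Data.Nat.Properties
open import Algebra.Properties.CommutativeSemigroup +-commutativeSemigroup using (interchange)
open import Data.Product using (_,_; _×_; proj₂; ∃; ∃₂)
open import Data.Sum using (_⊎_; inj₁; inj₂)
open import Function using (_∘′_)
open import Relation.Binary.PropositionalEquality hiding ([_])
open import Relation.Nullary using (¬_; yes; no)
open import Relation.Unary using (Decidable)
open import Relation.Unary.Properties using (_∪?_; _∩?_)

count : {A : Set} {P : A → Set} → Decidable P → List A → ℕ
count P? xs = length (filter P? xs)

module _ {A : Set} where

  count-mono : ∀ {P Q : A → Set} (P? : Decidable P) (Q? : Decidable Q) xs →
               (∀ {x} → x ∈ xs → P x → Q x) → count P? xs ≤ count Q? xs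
  count-mono P? Q? [] P⇒Q = z≤n
  count-mono P? Q? (x ∷ xs) P⇒Q with ih ← count-mono P? Q? xs (P⇒Q ∘′ there) | P? x | Q? x
  ... | yes _  | yes _  = s≤s ih
  ... | yes px | no ¬qx = ⊥-elim (¬qx (P⇒Q (here refl) px))
  ... | no _   | yes _  = m≤n⇒m≤1+n ih
  ... | no _   | no _   = ih

  count-∪ : ∀ {P Q : A → Set} (P? : Decidable P) (Q? : Decidable Q) xs →
            count (P? ∪? Q?) xs ≤ count P? xs + count Q? xs
  count-∪ P? Q? [] = z≤n
  count-∪ P? Q? (x ∷ xs) with ih ← count-∪ P? Q? xs | P? x | Q? x
  ... | yes _ | yes _ = s≤s (≤-trans ih (+-monoʳ-≤ _ (n≤1+n _)))
  ... | yes _ | no _  = s≤s ih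
  ... | no _  | yes _ = ≤-trans (s≤s ih) (≤-reflexive (sym (+-suc _ _)))
  ... | no _  | no _  = ih

  count-none : ∀ {P : A → Set} (P? : Decidable P) xs →
               (∀ {x} → x ∈ xs → ¬ P x) → count P? xs ≡ 0
  count-none P? xs ¬P = cong length (filter-none P? (All.tabulate ¬P))

  count-++ : ∀ {P : A → Set} (P? : Decidable P) xs ys →
             count P? (xs ++ ys) ≡ count P? xs + count P? ys
  count-++ P? xs ys = trans (cong length (filter-++ P? xs ys)) (length-++ (filter P? xs))

  count-map : ∀ {B : Set} {P : A → Set} (P? : Decidable P) (f : B → A) xs →
              count P? (map f xs) ≡ count (λ x → P? (f x)) xs
  count-map P? f [] = refl
  count-map P? f (x ∷ xs) with P? (f x)
  ... | yes _ = cong suc (count-map P? f xs)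
  ... | no _  = count-map P? f xs

module _ {P : List ℕ → Set} (P? : Decidable P) where

  count-sublists-∷ : ∀ x xs → count P? (sublists (x ∷ xs)) ≡
                     count (λ ys → P? (x ∷ ys)) (sublists xs) + count P? (sublists xs)
  count-sublists-∷ x xs =
    trans (count-++ P? (map (x ∷_) (sublists xs)) (sublists xs))
          (cong (_+ count P? (sublists xs)) (count-map P? (x ∷_) (sublists xs)))

count-sublists-∷ʳ : ∀ {P : List ℕ → Set} (P? : Decidable P) xs y →
                    count P? (sublists (xs ++ [ y ])) ≡
                    count (λ ys → P? (ys ++ [ y ])) (sublists xs) + count P? (sublists xs)
count-sublists-∷ʳ P? []       y with P? [ y ]
... | yes _ = refl
... | no _  = refl
count-sublists-∷ʳ P? (x ∷ xs) y = begin
  count P? (sublists (x ∷ xs ++ [ y ]))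
    ≡⟨ count-sublists-∷ P? x (xs ++ [ y ]) ⟩
  count (λ ys → P? (x ∷ ys)) (sublists (xs ++ [ y ])) + count P? (sublists (xs ++ [ y ]))
    ≡⟨ cong₂ _+_ (count-sublists-∷ʳ (λ ys → P? (x ∷ ys)) xs y) (count-sublists-∷ʳ P? xs y) ⟩
  (c[x∷ys∷ʳy] + c[x∷ys]) + (c[ys∷ʳy] + c[ys])
    ≡⟨ interchange c[x∷ys∷ʳy] c[x∷ys] c[ys∷ʳy] c[ys] ⟩
  (c[x∷ys∷ʳy] + c[ys∷ʳy]) + (c[x∷ys] + c[ys])
    ≡⟨ sym (cong₂ _+_ (count-sublists-∷ (λ ys → P? (ys ++ [ y ])) x xs) (count-sublists-∷ P? x xs)) ⟩
  count (λ ys → P? (ys ++ [ y ])) (sublists (x ∷ xs)) + count P? (sublists (x ∷ xs)) ∎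
  where
  open ≡-Reasoning
  c[x∷ys∷ʳy] = count (λ ys → P? (x ∷ ys ++ [ y ])) (sublists xs)
  c[x∷ys]    = count (λ ys → P? (x ∷ ys)) (sublists xs)
  c[ys∷ʳy]   = count (λ ys → P? (ys ++ [ y ])) (sublists xs)
  c[ys]      = count P? (sublists xs)

sublists-map : ∀ (f : ℕ → ℕ) xs → sublists (map f xs) ≡ map (map f) (sublists xs)
sublists-map f []       = refl
sublists-map f (x ∷ xs) = begin
  map (f x ∷_) (sublists (map f xs)) ++ sublists (map f xs)
    ≡⟨ cong (λ zss → map (f x ∷_) zss ++ zss) (sublists-map f xs) ⟩
  map (f x ∷_) (map (map f) (sublists xs)) ++ map (map f) (sublists xs)
    ≡⟨ cong (_++ map (map f) (sublists xs)) (sym (map-∘ (sublists xs))) ⟩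
  map (map f ∘′ (x ∷_)) (sublists xs) ++ map (map f) (sublists xs)
    ≡⟨ cong (_++ map (map f) (sublists xs)) (map-∘ (sublists xs)) ⟩
  map (map f) (map (x ∷_) (sublists xs)) ++ map (map f) (sublists xs)
    ≡⟨ sym (map-++ (map f) (map (x ∷_) (sublists xs)) (sublists xs)) ⟩
  map (map f) (map (x ∷_) (sublists xs) ++ sublists xs) ∎
  where open ≡-Reasoning

All-sublists : ∀ {Q : ℕ → Set} {xs ys} → ys ∈ sublists xs → All Q xs → All Q ys
All-sublists {xs = []}     (here refl) []         = []
All-sublists {xs = x ∷ xs} ys∈         (qx ∷ qxs) with ∈-++⁻ (map (x ∷_) (sublists xs)) ys∈
... | inj₂ ys∈′ = All-sublists ys∈′ qxs
... | inj₁ ys∈′ with ∈-map⁻ (x ∷_) ys∈′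
...   | zs , zs∈ , refl = qx ∷ All-sublists zs∈ qxs

count-sublists-filter : ∀ {Q : ℕ → Set} {R : List ℕ → Set} (Q? : Decidable Q) (R? : Decidable R) xs →
                        count (all? Q? ∩? R?) (sublists xs) ≤ count R? (sublists (filter Q? xs))
count-sublists-filter Q? R? []       = count-mono (all? Q? ∩? R?) R? (sublists []) (λ _ → proj₂)
count-sublists-filter Q? R? (x ∷ xs) with Q? x
... | yes qx = begin
  count (all? Q? ∩? R?) (sublists (x ∷ xs))
    ≡⟨ count-sublists-∷ (all? Q? ∩? R?) x xs ⟩
  count (λ ys → (all? Q? ∩? R?) (x ∷ ys)) (sublists xs) + count (all? Q? ∩? R?) (sublists xs)
    ≤⟨ +-monoˡ-≤ _ (count-mono _ (all? Q? ∩? (λ ys → R? (x ∷ ys))) (sublists xs)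
                      (λ { _ (_ ∷ qys , r) → qys , r })) ⟩
  count (all? Q? ∩? (λ ys → R? (x ∷ ys))) (sublists xs) + count (all? Q? ∩? R?) (sublists xs)
    ≤⟨ +-mono-≤ (count-sublists-filter Q? (λ ys → R? (x ∷ ys)) xs) (count-sublists-filter Q? R? xs) ⟩
  count (λ ys → R? (x ∷ ys)) (sublists (filter Q? xs)) + count R? (sublists (filter Q? xs))
    ≡⟨ sym (count-sublists-∷ R? x (filter Q? xs)) ⟩
  count R? (sublists (x ∷ filter Q? xs)) ∎
  where open ≤-Reasoning
... | no ¬qx = begin
  count (all? Q? ∩? R?) (sublists (x ∷ xs))
    ≡⟨ count-sublists-∷ (all? Q? ∩? R?) x xs ⟩
  count (λ ys → (all? Q? ∩? R?) (x ∷ ys)) (sublists xs) + count (all? Q? ∩? R?) (sublists xs)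
    ≡⟨ cong (_+ _) (count-none _ (sublists xs) (λ { _ (qx ∷ _ , _) → ¬qx qx })) ⟩
  count (all? Q? ∩? R?) (sublists xs)
    ≤⟨ count-sublists-filter Q? R? xs ⟩
  count R? (sublists (filter Q? xs)) ∎
  where open ≤-Reasoning

n<m^n : ∀ {m} → 1 < m → ∀ n → n < m ^ n
n<m^n 1<m zero    = s≤s z≤n
n<m^n {m@(suc _)} 1<m (suc n) = begin-strict
  suc n           ≤⟨ n<m^n 1<m n ⟩
  m ^ n           <⟨ m<m*n (m ^ n) m 1<m ⟩
  m ^ n * m       ≡⟨ *-comm (m ^ n) m ⟩
  m * m ^ n       ∎
  where
  open ≤-Reasoning
  instance _ = m^n≢0 m n

module _ {p q : ℕ} where

  IsPQ⁺ : 1 < p → 1 < q → ∀ {n} i j → n ≡ p ^ i * q ^ j → IsPQ p q n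
  IsPQ⁺ 1<p 1<q {n} i j n≡ = lose (∈-upTo⁺ (s≤s i≤n)) (lose (∈-upTo⁺ (s≤s j≤n)) n≡)
    where
    instance
      p^i≢0 : NonZero (p ^ i)
      p^i≢0 = m^n≢0 p i {{>-nonZero (<⇒≤ 1<p)}}
      q^j≢0 : NonZero (q ^ j)
      q^j≢0 = m^n≢0 q j {{>-nonZero (<⇒≤ 1<q)}}
    i≤n : i ≤ n
    i≤n = ≤-trans (<⇒≤ (n<m^n 1<p i)) (≤-trans (m≤m*n (p ^ i) (q ^ j)) (≤-reflexive (sym n≡)))
    j≤n : j ≤ n
    j≤n = ≤-trans (<⇒≤ (n<m^n 1<q j)) (≤-trans (m≤n*m (q ^ j) (p ^ i)) (≤-reflexive (sym n≡)))

  IsPQ⁻ : ∀ {n} → IsPQ p q n → ∃₂ λ i j → n ≡ p ^ i * q ^ j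
  IsPQ⁻ pq with i , j-any ← satisfied pq with j , n≡ ← satisfied j-any = i , j , n≡

  IsPQ⇒∣ : ∀ {n} → IsPQ p q n → 2 ≤ n → p ∣ n ⊎ q ∣ n
  IsPQ⇒∣ pq 2≤n with IsPQ⁻ pq
  ... | zero  , zero  , refl = ⊥-elim (<-irrefl refl 2≤n)
  ... | suc i , j     , refl = inj₁ (∣m⇒∣m*n (q ^ j) (m∣m*n (p ^ i)))
  ... | zero  , suc j , refl = inj₂ (∣n⇒∣m*n 1 (m∣m*n (q ^ j)))

∤-coprime-^ : ∀ {r s} → 1 < r → Coprime r s → ∀ j → ¬ r ∣ s ^ j
∤-coprime-^ 1<r r⊥s zero    r∣1   = <-irrefl (sym (∣1⇒≡1 r∣1)) 1<r
∤-coprime-^ 1<r r⊥s (suc j) r∣s^j = ∤-coprime-^ 1<r r⊥s j (coprime-divisor r⊥s r∣s^j)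

^-*-cancelˡ : ∀ {r s} → 1 < r → Coprime r s → ∀ {y} i j → r * y ≡ r ^ i * s ^ j →
              ∃ λ i′ → y ≡ r ^ i′ * s ^ j
^-*-cancelˡ {r} {s} 1<r r⊥s {y} zero j ry≡ =
  ⊥-elim (∤-coprime-^ 1<r r⊥s j (divides y (trans (sym (*-identityˡ (s ^ j))) (trans (sym ry≡) (*-comm r y)))))
^-*-cancelˡ {r@(suc _)} {s} 1<r r⊥s {y} (suc i) j ry≡ =
  i , *-cancelˡ-≡ y (r ^ i * s ^ j) r (trans ry≡ (*-assoc r (r ^ i) (s ^ j)))

module _ {p q : ℕ} (1<p : 1 < p) (1<q : 1 < q) (p⊥q : Coprime p q) where

  IsPQ-cancelˡ : ∀ {y} → IsPQ p q (p * y) → IsPQ p q y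
  IsPQ-cancelˡ pq with i , j , py≡ ← IsPQ⁻ pq with i′ , y≡ ← ^-*-cancelˡ 1<p p⊥q i j py≡ =
    IsPQ⁺ 1<p 1<q i′ j y≡

  IsPQ-cancelʳ : ∀ {y} → IsPQ p q (q * y) → IsPQ p q y
  IsPQ-cancelʳ {y} pq with i , j , qy≡ ← IsPQ⁻ pq
    with j′ , y≡ ← ^-*-cancelˡ 1<q (Coprime.sym p⊥q) j i (trans qy≡ (*-comm (p ^ i) (q ^ j))) =
    IsPQ⁺ 1<p 1<q i j′ (trans y≡ (*-comm (q ^ j′) (p ^ i)))

pq-chain-divisible : ∀ {p q x xs} → Linked (λ a b → b ∣ a) (x ∷ xs) → All (IsPQ p q) (x ∷ xs) →
                     All (2 ≤_) (x ∷ xs) → All (p ∣_) (x ∷ xs) ⊎ All (q ∣_) (x ∷ xs)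
pq-chain-divisible {xs = []} _ (pq ∷ []) (2≤x ∷ []) with IsPQ⇒∣ pq 2≤x
... | inj₁ p∣x = inj₁ (p∣x ∷ [])
... | inj₂ q∣x = inj₂ (q∣x ∷ [])
pq-chain-divisible {xs = _ ∷ _} (y∣x ∷ chain) (_ ∷ pqs) (_ ∷ 2≤s) with pq-chain-divisible chain pqs 2≤s
... | inj₁ (p∣y ∷ p∣s) = inj₁ (∣-trans p∣y y∣x ∷ p∣y ∷ p∣s)
... | inj₂ (q∣y ∷ q∣s) = inj₂ (∣-trans q∣y y∣x ∷ q∣y ∷ q∣s)

∣-sum : ∀ {r} ys → All (r ∣_) ys → r ∣ sum ys
∣-sum []       []           = _ ∣0
∣-sum (y ∷ ys) (r∣y ∷ r∣ys) = ∣m∣n⇒∣m+n r∣y (∣-sum ys r∣ys)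

sum-map-*ˡ : ∀ r ys → sum (map (r *_) ys) ≡ r * sum ys
sum-map-*ˡ r []       = sym (*-zeroʳ r)
sum-map-*ˡ r (y ∷ ys) = trans (cong (r * y +_) (sum-map-*ˡ r ys)) (sym (*-distribˡ-+ r y (sum ys)))

linked-++⁻ˡ : ∀ {R : ℕ → ℕ → Set} xs {ys} → Linked R (xs ++ ys) → Linked R xs
linked-++⁻ˡ []           _         = []
linked-++⁻ˡ (x ∷ [])     _         = [-]
linked-++⁻ˡ (x ∷ y ∷ xs) (r ∷ rxs) = r ∷ linked-++⁻ˡ (y ∷ xs) rxs

module _ {p q : ℕ} where

  ¬IsChained-[] : ∀ {U} → 1 ≤ U → ¬ IsChained p q U []
  ¬IsChained-[] () (refl , _)

  IsChained-∷ʳ-1 : ∀ V ys → IsChained p q (suc V) (ys ++ [ 1 ]) → IsChained p q V ys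
  IsChained-∷ʳ-1 V ys (Σys≡ , pqs , chain) =
    suc-injective (trans (+-comm 1 (sum ys)) (trans (sym (sum-++ ys [ 1 ])) Σys≡)) ,
    ++⁻ˡ ys pqs ,
    linked-++⁻ˡ ys chain

  IsChained-*⁻ : ∀ r .{{_ : NonZero r}} → (∀ {y} → IsPQ p q (r * y) → IsPQ p q y) →
                 ∀ k ys → IsChained p q (r * k) (map (r *_) ys) → IsChained p q k ys
  IsChained-*⁻ r cancel k ys (Σys≡ , pqs , chain) =
    *-cancelˡ-≡ (sum ys) k r (trans (sym (sum-map-*ˡ r ys)) Σys≡) ,
    All.map cancel (map⁻ pqs) ,
    Linked.map (*-cancelˡ-∣ r) (Linked.map⁻ chain)

downFrom⁺ : ℕ → List ℕ
downFrom⁺ U = map suc (downFrom U)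

downFrom⁺⁺ : ℕ → List ℕ
downFrom⁺⁺ V = map (λ n → suc (suc n)) (downFrom V)

downFrom⁺-suc : ∀ V → downFrom⁺ (suc V) ≡ downFrom⁺⁺ V ++ [ 1 ]
downFrom⁺-suc zero    = refl
downFrom⁺-suc (suc V) = cong (suc (suc V) ∷_) (downFrom⁺-suc V)

All-2≤-downFrom⁺⁺ : ∀ V → All (2 ≤_) (downFrom⁺⁺ V)
All-2≤-downFrom⁺⁺ zero    = []
All-2≤-downFrom⁺⁺ (suc V) = s≤s (s≤s z≤n) ∷ All-2≤-downFrom⁺⁺ V

filter-∣-downFrom⁺⁺ : ∀ {r} → 1 < r → ∀ V → filter (r ∣?_) (downFrom⁺⁺ V) ≡ filter (r ∣?_) (downFrom⁺ (suc V))
filter-∣-downFrom⁺⁺ {r} 1<r V = sym (begin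
  filter (r ∣?_) (downFrom⁺ (suc V))              ≡⟨ cong (filter (r ∣?_)) (downFrom⁺-suc V) ⟩
  filter (r ∣?_) (downFrom⁺⁺ V ++ [ 1 ])          ≡⟨ filter-++ (r ∣?_) (downFrom⁺⁺ V) [ 1 ] ⟩
  filter (r ∣?_) (downFrom⁺⁺ V) ++ filter (r ∣?_) [ 1 ]
    ≡⟨ cong (filter (r ∣?_) (downFrom⁺⁺ V) ++_) (filter-reject (r ∣?_) (λ r∣1 → <-irrefl (sym (∣1⇒≡1 r∣1)) 1<r)) ⟩
  filter (r ∣?_) (downFrom⁺⁺ V) ++ []             ≡⟨ ++-identityʳ _ ⟩
  filter (r ∣?_) (downFrom⁺⁺ V)                   ∎)
  where open ≡-Reasoning

∣-between⇒≡ : ∀ {r k n} → r * k ≤ n → n < r * suc k → r ∣ n → n ≡ r * k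
∣-between⇒≡ {r@(suc _)} {k} {n} rk≤n n<r[k+1] (divides c refl) = trans (cong (_* r) c≡k) (*-comm k r)
  where
  c≡k : c ≡ k
  c≡k = ≤-antisym (≤-pred (*-cancelˡ-< r c (suc k) (subst (_< r * suc k) (*-comm c r) n<r[k+1])))
                  (*-cancelˡ-≤ r (subst (r * k ≤_) (*-comm c r) rk≤n))

filter-∣-downFrom⁺ : ∀ r .{{_ : NonZero r}} U k → r * k ≤ U → U < r * suc k →
                     filter (r ∣?_) (downFrom⁺ U) ≡ map (r *_) (downFrom⁺ k)
filter-∣-downFrom⁺ r       zero    zero    _   _ = refl
filter-∣-downFrom⁺ (suc _) zero    (suc k) ()  _
filter-∣-downFrom⁺ r       (suc U) k       rk≤1+U 1+U<r[k+1] with r ∣? suc U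
... | no r∤1+U = filter-∣-downFrom⁺ r U k rk≤U (<⇒≤ 1+U<r[k+1])
  where
  rk≤U : r * k ≤ U
  rk≤U = ≤-pred (≤∧≢⇒< rk≤1+U (λ rk≡ → r∤1+U (subst (r ∣_) rk≡ (m∣m*n k))))
... | yes r∣1+U = multiple k (∣-between⇒≡ rk≤1+U 1+U<r[k+1] r∣1+U)
  where
  multiple : ∀ k → suc U ≡ r * k → suc U ∷ filter (r ∣?_) (downFrom⁺ U) ≡ map (r *_) (downFrom⁺ k)
  multiple zero    1+U≡ = ⊥-elim (1+n≢0 (trans 1+U≡ (*-zeroʳ r)))
  multiple (suc k) 1+U≡ = cong₂ _∷_ 1+U≡ (filter-∣-downFrom⁺ r U k rk≤U (≤-reflexive 1+U≡))
    where
    rk≤U : r * k ≤ U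
    rk≤U = ≤-pred (begin
      suc (r * k) ≤⟨ +-monoˡ-≤ (r * k) (>-nonZero⁻¹ r) ⟩
      r + r * k   ≡⟨ sym (*-suc r k) ⟩
      r * suc k   ≡⟨ sym 1+U≡ ⟩
      suc U       ∎)
      where open ≤-Reasoning

^-distribʳ-* : ∀ m n o → (m * n) ^ o ≡ m ^ o * n ^ o
^-distribʳ-* m n zero    = refl
^-distribʳ-* m n (suc o) = trans (cong (m * n *_) (^-distribʳ-* m n o)) ([m*n]*[o*p]≡[m*o]*[n*p] m n (m ^ o) (n ^ o))

module _ {p q : ℕ} where

  LeUPowBeta-mono : ∀ {w w′ U} → w′ ≤ w → LeUPowBeta p q w U → LeUPowBeta p q w′ U
  LeUPowBeta-mono w′≤w w≤U^β a b 0<b U^a<w′^b = w≤U^β a b 0<b (<-≤-trans U^a<w′^b (^-monoˡ-≤ b w′≤w))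

  LeUPowBeta-0 : ∀ {U} → LeUPowBeta p q 0 U
  LeUPowBeta-0 a (suc b) _ ()

  LeUPowBeta-1 : ∀ {U} → 1 ≤ U → LeUPowBeta p q 1 U
  LeUPowBeta-1 {suc U} _ a b _ U^a<1^b =
    ⊥-elim (<-irrefl refl (<-≤-trans (m^n>0 (suc U) a) (≤-pred (subst (_ <_) (^-zeroˡ b) U^a<1^b))))

  -- Unless a hypothesis applies directly, w₁ ≤ A^(a/b) ≤ (U/p)^(a/b) and w₂ ≤ (U/q)^(a/b) while
  -- w₁ + w₂ > U^(a/b), so m = w₁, k = w₂, n = w₁ + w₂ witness p^(-a/b) + q^(-a/b) > 1.
  LeUPowBeta-+ : ∀ {w₁ w₂ A B U} → p * A ≤ U → q * B ≤ U →
                 LeUPowBeta p q w₁ A → LeUPowBeta p q w₂ B → LeUPowBeta p q (w₁ + w₂) U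
  LeUPowBeta-+ {w₁} {w₂} {A} {B} {U} pA≤U qB≤U w₁≤A^β w₂≤B^β a b 0<b U^a<w^b
    with A ^ a <? w₁ ^ b | B ^ a <? w₂ ^ b
  ... | yes A^a<w₁^b | _            = w₁≤A^β a b 0<b A^a<w₁^b
  ... | no _         | yes B^a<w₂^b = w₂≤B^β a b 0<b B^a<w₂^b
  ... | no A^a≮w₁^b  | no B^a≮w₂^b  = w₁ , w₂ , w₁ + w₂ , ≤-refl ,
                                      scaled A^a≮w₁^b pA≤U , scaled B^a≮w₂^b qB≤U
    where
    scaled : ∀ {r C w} → ¬ C ^ a < w ^ b → r * C ≤ U → w ^ b * r ^ a < (w₁ + w₂) ^ b
    scaled {r} {C} {w} C^a≮w^b rC≤U = begin-strict
      w ^ b * r ^ a   ≤⟨ *-monoˡ-≤ (r ^ a) (≮⇒≥ C^a≮w^b) ⟩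
      C ^ a * r ^ a   ≡⟨ sym (^-distribʳ-* C r a) ⟩
      (C * r) ^ a     ≤⟨ ^-monoˡ-≤ a (subst (_≤ U) (*-comm r C) rC≤U) ⟩
      U ^ a           <⟨ U^a<w^b ⟩
      (w₁ + w₂) ^ b   ∎
      where open ≤-Reasoning

W≤U^β : ℕ → ℕ → ℕ → Set
W≤U^β p q U = 1 ≤ U → LeUPowBeta p q (W p q U) U

W-1 : ∀ p q → W p q 1 ≡ 1
W-1 p q = refl

module _ {p q : ℕ} (1<p : 1 < p) (1<q : 1 < q) (p⊥q : Coprime p q) where

  -- W₂ U V counts the chained partitions of U with parts in {2, …, V + 1};
  -- W₂∣ r U V those whose parts are moreover all divisible by r.
  W₂ : ℕ → ℕ → ℕ
  W₂ U V = count (isChained? p q U) (sublists (downFrom⁺⁺ V))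

  W₂∣ : ℕ → ℕ → ℕ → ℕ
  W₂∣ r U V = count (all? (r ∣?_) ∩? isChained? p q U) (sublists (downFrom⁺⁺ V))

  W-suc≤ : ∀ V → W p q (suc V) ≤ W₂ V V + W₂ (suc V) V
  W-suc≤ V = begin
    W p q (suc V)
      ≡⟨ cong (λ xs → count (isChained? p q (suc V)) (sublists xs)) (downFrom⁺-suc V) ⟩
    count (isChained? p q (suc V)) (sublists (downFrom⁺⁺ V ++ [ 1 ]))
      ≡⟨ count-sublists-∷ʳ (isChained? p q (suc V)) (downFrom⁺⁺ V) 1 ⟩
    count (λ ys → isChained? p q (suc V) (ys ++ [ 1 ])) (sublists (downFrom⁺⁺ V)) + W₂ (suc V) V
      ≤⟨ +-monoˡ-≤ _ (count-mono _ (isChained? p q V) (sublists (downFrom⁺⁺ V)) (λ _ → IsChained-∷ʳ-1 V _)) ⟩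
    W₂ V V + W₂ (suc V) V ∎
    where open ≤-Reasoning

  W₂≤ : ∀ {U} V → 1 ≤ U → W₂ U V ≤ W₂∣ p U V + W₂∣ q U V
  W₂≤ {U} V 1≤U = ≤-trans (count-mono (isChained? p q U) (W₂∣-p ∪? W₂∣-q) (sublists (downFrom⁺⁺ V)) divisible)
                          (count-∪ W₂∣-p W₂∣-q (sublists (downFrom⁺⁺ V)))
    where
    W₂∣-p = all? (p ∣?_) ∩? isChained? p q U
    W₂∣-q = all? (q ∣?_) ∩? isChained? p q U
    divisible : ∀ {ys} → ys ∈ sublists (downFrom⁺⁺ V) → IsChained p q U ys →
                (All (p ∣_) ys × IsChained p q U ys) ⊎ (All (q ∣_) ys × IsChained p q U ys)
    divisible {[]}    _   ch = ⊥-elim (¬IsChained-[] 1≤U ch)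
    divisible {_ ∷ _} ys∈ ch@(_ , pqs , chain)
      with pq-chain-divisible chain pqs (All-sublists ys∈ (All-2≤-downFrom⁺⁺ V))
    ... | inj₁ p∣ys = inj₁ (p∣ys , ch)
    ... | inj₂ q∣ys = inj₂ (q∣ys , ch)

  W₂∣≡0 : ∀ {r U} V → ¬ r ∣ U → W₂∣ r U V ≡ 0
  W₂∣≡0 {r} {U} V r∤U = count-none (all? (r ∣?_) ∩? isChained? p q U) (sublists (downFrom⁺⁺ V))
    (λ { {ys} _ (r∣ys , Σys≡U , _) → r∤U (subst (r ∣_) Σys≡U (∣-sum ys r∣ys)) })

  W₂∣≤W : ∀ {r} → 1 < r → (∀ {y} → IsPQ p q (r * y) → IsPQ p q y) →
          ∀ {U k} V → U ≡ r * k → V ≤ U → U ≤ suc V → W₂∣ r U V ≤ W p q k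
  W₂∣≤W {r@(suc _)} 1<r cancel {U} {k} V U≡rk V≤U U≤1+V = begin
    W₂∣ r U V
      ≤⟨ count-sublists-filter (r ∣?_) (isChained? p q U) (downFrom⁺⁺ V) ⟩
    count (isChained? p q U) (sublists (filter (r ∣?_) (downFrom⁺⁺ V)))
      ≡⟨ cong (λ xs → count (isChained? p q U) (sublists xs)) multiples ⟩
    count (isChained? p q U) (sublists (map (r *_) (downFrom⁺ k)))
      ≡⟨ cong (count (isChained? p q U)) (sublists-map (r *_) (downFrom⁺ k)) ⟩
    count (isChained? p q U) (map (map (r *_)) (sublists (downFrom⁺ k)))
      ≡⟨ count-map (isChained? p q U) (map (r *_)) (sublists (downFrom⁺ k)) ⟩
    count (λ ys → isChained? p q U (map (r *_) ys)) (sublists (downFrom⁺ k))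
      ≤⟨ count-mono _ (isChained? p q k) (sublists (downFrom⁺ k))
           (λ {ys} _ → IsChained-*⁻ r cancel k ys ∘′ subst (λ u → IsChained p q u (map (r *_) ys)) U≡rk) ⟩
    W p q k ∎
    where
    open ≤-Reasoning
    1+V<r[k+1] : suc V < r * suc k
    1+V<r[k+1] = begin
      2 + V  ≤⟨ s≤s (s≤s V≤U) ⟩
      2 + U  ≡⟨ +-comm 2 U ⟩
      U + 2  ≤⟨ +-monoʳ-≤ U 1<r ⟩
      U + r  ≡⟨ trans (cong (_+ r) U≡rk) (trans (+-comm (r * k) r) (sym (*-suc r k))) ⟩
      r * suc k ∎
    multiples : filter (r ∣?_) (downFrom⁺⁺ V) ≡ map (r *_) (downFrom⁺ k)
    multiples = trans (filter-∣-downFrom⁺⁺ 1<r V)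
                      (filter-∣-downFrom⁺ r (suc V) k (subst (_≤ suc V) U≡rk U≤1+V) 1+V<r[k+1])

  module _ {r} (1<r : 1 < r) (cancel : ∀ {y} → IsPQ p q (r * y) → IsPQ p q y)
           {V} (ih : <-Rec (W≤U^β p q) (suc V)) where

    LeUPowBeta-W₂∣ : ∀ {U} k → U ≡ r * k → V ≤ U → U ≤ suc V → 1 ≤ U → LeUPowBeta p q (W₂∣ r U V) k
    LeUPowBeta-W₂∣ zero    U≡r*0 _   _     1≤U = ⊥-elim (<-irrefl (sym (trans U≡r*0 (*-zeroʳ r))) 1≤U)
    LeUPowBeta-W₂∣ (suc k) U≡rk  V≤U U≤1+V _   =
      LeUPowBeta-mono (W₂∣≤W 1<r cancel V U≡rk V≤U U≤1+V) (ih k<1+V (s≤s z≤n))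
      where
      k<1+V : suc k < suc V
      k<1+V = <-≤-trans (subst (suc k <_) (*-comm (suc k) r) (m<m*n (suc k) r 1<r)) (subst (_≤ suc V) U≡rk U≤1+V)

    W₂∣-bound : 1 ≤ V → ∃ λ A → r * A ≤ suc V × LeUPowBeta p q (W₂∣ r V V + W₂∣ r (suc V) V) A
    W₂∣-bound 1≤V with r ∣? suc V | r ∣? V
    ... | yes (divides k 1+V≡) | yes r∣V = ⊥-elim (<-irrefl (sym (∣1⇒≡1 r∣1)) 1<r)
      where r∣1 = ∣m+n∣m⇒∣n (subst (r ∣_) (+-comm 1 V) (divides k 1+V≡)) r∣V
    ... | yes (divides k 1+V≡) | no r∤V =
      k , ≤-reflexive (sym 1+V≡rk) ,
      LeUPowBeta-mono (≤-reflexive (cong (_+ W₂∣ r (suc V) V) (W₂∣≡0 V r∤V)))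
                      (LeUPowBeta-W₂∣ k 1+V≡rk (n≤1+n V) ≤-refl (s≤s z≤n))
      where 1+V≡rk = trans 1+V≡ (*-comm k r)
    ... | no r∤1+V | yes (divides k V≡) =
      k , ≤-trans (≤-reflexive (sym V≡rk)) (n≤1+n V) ,
      LeUPowBeta-mono (≤-reflexive (trans (cong (W₂∣ r V V +_) (W₂∣≡0 V r∤1+V)) (+-identityʳ (W₂∣ r V V))))
                      (LeUPowBeta-W₂∣ k V≡rk ≤-refl (n≤1+n V) 1≤V)
      where V≡rk = trans V≡ (*-comm k r)
    ... | no r∤1+V | no r∤V =
      0 , ≤-trans (≤-reflexive (*-zeroʳ r)) z≤n ,
      LeUPowBeta-mono (≤-reflexive (cong₂ _+_ (W₂∣≡0 V r∤V) (W₂∣≡0 V r∤1+V))) LeUPowBeta-0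

  W-suc-bound : ∀ V → 1 ≤ V → <-Rec (W≤U^β p q) (suc V) → LeUPowBeta p q (W p q (suc V)) (suc V)
  W-suc-bound V 1≤V ih
    with A , pA≤1+V , boundA ← W₂∣-bound 1<p (IsPQ-cancelˡ 1<p 1<q p⊥q) ih 1≤V
       | B , qB≤1+V , boundB ← W₂∣-bound 1<q (IsPQ-cancelʳ 1<p 1<q p⊥q) ih 1≤V
    = LeUPowBeta-mono W≤ (LeUPowBeta-+ pA≤1+V qB≤1+V boundA boundB)
    where
    W≤ : W p q (suc V) ≤ (W₂∣ p V V + W₂∣ p (suc V) V) + (W₂∣ q V V + W₂∣ q (suc V) V)
    W≤ = begin
      W p q (suc V)                                             ≤⟨ W-suc≤ V ⟩
      W₂ V V + W₂ (suc V) V                                     ≤⟨ +-mono-≤ (W₂≤ V 1≤V) (W₂≤ V (s≤s z≤n)) ⟩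
      (W₂∣ p V V + W₂∣ q V V) + (W₂∣ p (suc V) V + W₂∣ q (suc V) V)
        ≡⟨ interchange (W₂∣ p V V) (W₂∣ q V V) (W₂∣ p (suc V) V) (W₂∣ q (suc V) V) ⟩
      (W₂∣ p V V + W₂∣ p (suc V) V) + (W₂∣ q V V + W₂∣ q (suc V) V) ∎
      where open ≤-Reasoning

proposition5p2 : ∀ (p q : ℕ) → 1 < p → 1 < q → Coprime p q →
    ∀ (U : ℕ) → 1 ≤ U → LeUPowBeta p q (W p q U) U
proposition5p2 p q 1<p 1<q p⊥q = <-rec (W≤U^β p q) bound
  where
  bound : ∀ U → <-Rec (W≤U^β p q) U → W≤U^β p q U
  bound zero          _  ()
  bound 1             _  _ = LeUPowBeta-mono (≤-reflexive (W-1 p q)) (LeUPowBeta-1 ≤-refl)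
  bound (suc (suc V)) ih _ = W-suc-bound 1<p 1<q p⊥q (suc V) (s≤s z≤n) ih
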